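{- Consider the construction described in the context. For all distinct $i,j,l\in[k]$ with $j<l$: if $w\in V(G')$ is $H_i$-representative, then for every $\{x,y\}\in T_{j,l}$ we have $d(x,w)+d(w,y)>(1+\alpha)\cdot d(x,y)$.
   Context: Let $G$ be a graph whose vertex set is partitioned into $V_1,\dots,V_k$ with $V_i=\{v_{i,1},\dots,v_{i,n}\}$, $n$ odd. Fix rational $\alpha$ with $0<\alpha\le 0.5$, and set $L=\lceil n/(2\alpha)\rceil$, $L_p=\lceil (n-1)/\alpha\rceil$. The graph $G'$ (unweighted; $d$ denotes its shortest-path distance) is built as follows: a vertex $b$; for each $i\in[k]$: vertices $u'_{i,1},\dots,u'_{i,n}$ forming a path in this order, vertices $u_{i,1},\dots,u_{i,n}$ forming a path in this order, a vertex $z_i$ adjacent to $u'_{i,1}$ and $u_{i,n}$, a vertex $z'_i$ adjacent to $u'_{i,n}$ and $u_{i,1}$, and a vertex $p_i$ joined to $u_{i,(n+1)/2}$ by a path $P(p_i,u_{i,(n+1)/2})$ with $L_p-1$ new internal vertices; for each $i\in[k]$, $j\in[n]$: a path $P(u_{i,j},b)$ with $L-1$ new internal vertices and a path $P(u'_{i,j},b)$ with $L-1$ new internal vertices. For $i<j$ in $[k]$, $T_{i,j}=\{\{u'_{i,i'},u'_{j,j'}\}: i',j'\in[n],\ v_{i,i'}v_{j,j'}\in E(G)\}$. For $i\in[k]$, a vertex $w\in V(G')$ is $H_i$-representative if $w\in V(P(p_i,u_{i,(n+1)/2}))$ or $d(u_{i,(n+1)/2},w)\le (n-1)/2$. -}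

module Defs where

open import Data.Nat using (ℕ; zero; suc; _+_; _*_; _∸_; _≤_; _<_)
open import Data.Nat.DivMod using (_/_)
open import Data.Fin using (Fin; toℕ)
open import Data.Product using (_×_; ∃-syntax)
open import Data.Sum using (_⊎_)
open import Relation.Binary.PropositionalEquality using (_≡_)

⌈_/_⌉ : ℕ → ℕ → ℕ
⌈ a / zero ⌉ = 0
⌈ a / suc b ⌉ = (a + b) / suc b

-- The rational α is given as p / q (p, q naturals, 0 < p, 2p ≤ q).
-- L  = ⌈ n / (2α) ⌉ = ⌈ n q / (2 p) ⌉
-- Lp = ⌈ (n-1) / α ⌉ = ⌈ (n-1) q / p ⌉
Lof : (n p q : ℕ) → ℕ
Lof n p q = ⌈ n * q / 2 * p ⌉

Lpof : (n p q : ℕ) → ℕ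
Lpof n p q = ⌈ (n ∸ 1) * q / p ⌉

-- Indices are 0-based: u i j stands for u_{i,j+1}.
--   pv i t   (t : Fin Lp)     : vertex at distance t from p_i on P(p_i, u_{i,(n+1)/2});
--                               pv i 0 = p_i, the others are the Lp - 1 internal vertices
--   bu i j t (t : Fin (L ∸ 1)) : internal vertices of P(u_{i,j}, b), t = 0 next to u_{i,j}
--   bu' i j t                  : internal vertices of P(u'_{i,j}, b)
data Vtx (k n L Lp : ℕ) : Set where
  b   : Vtx k n L Lp
  u'  : Fin k → Fin n → Vtx k n L Lp
  u   : Fin k → Fin n → Vtx k n L Lp
  z   : Fin k → Vtx k n L Lp
  z'  : Fin k → Vtx k n L Lp
  pv  : Fin k → Fin Lp → Vtx k n L Lp
  bu  : Fin k → Fin n → Fin (L ∸ 1) → Vtx k n L Lp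
  bu' : Fin k → Fin n → Fin (L ∸ 1) → Vtx k n L Lp

-- Index (0-based) of the middle vertex u_{i,(n+1)/2}.
mid : ℕ → ℕ
mid n = n / 2

-- Directed version of the edge set of G' (edges are the symmetric closure).
data Arc {k n L Lp : ℕ} : Vtx k n L Lp → Vtx k n L Lp → Set where
  u'-path : ∀ i (j j' : Fin n) → toℕ j' ≡ suc (toℕ j) → Arc (u' i j) (u' i j')
  u-path  : ∀ i (j j' : Fin n) → toℕ j' ≡ suc (toℕ j) → Arc (u i j) (u i j')
  z-u'    : ∀ i (j : Fin n) → toℕ j ≡ 0 → Arc (z i) (u' i j)
  z-u     : ∀ i (j : Fin n) → suc (toℕ j) ≡ n → Arc (z i) (u i j)
  z'-u'   : ∀ i (j : Fin n) → suc (toℕ j) ≡ n → Arc (z' i) (u' i j)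
  z'-u    : ∀ i (j : Fin n) → toℕ j ≡ 0 → Arc (z' i) (u i j)
  p-path  : ∀ i (t t' : Fin Lp) → toℕ t' ≡ suc (toℕ t) → Arc (pv i t) (pv i t')
  p-end   : ∀ i (t : Fin Lp) (j : Fin n) → suc (toℕ t) ≡ Lp → toℕ j ≡ mid n →
            Arc (pv i t) (u i j)
  bu-start : ∀ i j (t : Fin (L ∸ 1)) → toℕ t ≡ 0 → Arc (u i j) (bu i j t)
  bu-path  : ∀ i j (t t' : Fin (L ∸ 1)) → toℕ t' ≡ suc (toℕ t) → Arc (bu i j t) (bu i j t')
  bu-end   : ∀ i j (t : Fin (L ∸ 1)) → suc (toℕ t) ≡ L ∸ 1 → Arc (bu i j t) b
  bu-direct : ∀ i j → L ≡ 1 → Arc (u i j) b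
  bu'-start : ∀ i j (t : Fin (L ∸ 1)) → toℕ t ≡ 0 → Arc (u' i j) (bu' i j t)
  bu'-path  : ∀ i j (t t' : Fin (L ∸ 1)) → toℕ t' ≡ suc (toℕ t) → Arc (bu' i j t) (bu' i j t')
  bu'-end   : ∀ i j (t : Fin (L ∸ 1)) → suc (toℕ t) ≡ L ∸ 1 → Arc (bu' i j t) b
  bu'-direct : ∀ i j → L ≡ 1 → Arc (u' i j) b

Edge : ∀ {k n L Lp} → Vtx k n L Lp → Vtx k n L Lp → Set
Edge x y = Arc x y ⊎ Arc y x

data Walk {k n L Lp : ℕ} : Vtx k n L Lp → Vtx k n L Lp → ℕ → Set where
  here : ∀ {x} → Walk x x 0
  step : ∀ {x y w m} → Edge x y → Walk y w m → Walk x w (suc m)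

IsDist : ∀ {k n L Lp} → Vtx k n L Lp → Vtx k n L Lp → ℕ → Set
IsDist x y m = Walk x y m × (∀ m' → Walk x y m' → m ≤ m')

V' : (k n p q : ℕ) → Set
V' k n p q = Vtx k n (Lof n p q) (Lpof n p q)

HRep : ∀ {k n L Lp} → Fin k → Vtx k n L Lp → Set
HRep {k} {n} {L} {Lp} i w =
    (∃[ t ] w ≡ pv i t)
  ⊎ (∃[ c ] (toℕ c ≡ mid n) × (w ≡ u i c))
  ⊎ (∃[ c ] ∃[ m ] (toℕ c ≡ mid n) × IsDist (u i c) w m × m ≤ (n ∸ 1) / 2)

Dist : (k n p q : ℕ) → V' k n p q → V' k n p q → ℕ → Set
Dist k n p q x y m = IsDist x y m

-- Measure vertices of G' by a potential that is 1-Lipschitz along edges: with respect to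
-- gadget j it is 0 on the u/u'-vertices of gadget j, L at b and 2L on the u/u'-vertices
-- of every other gadget (the pendant paths lie even further out).  A walk from u'_{j,·}
-- to an H_i-representative vertex w (i ≠ j) therefore has length at least
-- 2L - (n-1)/2, and likewise for gadget l, whereas the walk u'_{j,·} → b → u'_{l,·}
-- has length 2L.  Since L ≥ n / (2α), the slack (n-1)/2 is less than αL, so with α ≤ 1/2
-- d(x,w) + d(w,y) > 4L - 2αL ≥ (1 + α) 2L ≥ (1 + α) d(x,y).
module Submission where

open import Defs
open import Data.Bool using (Bool; true; false)
open import Data.Fin using (Fin; toℕ; fromℕ<)
open import Data.Fin.Properties using (toℕ-fromℕ<)
open import Data.Maybe using (Maybe; just; nothing)
open import Data.Maybe.Properties using (just-injective; ≡-dec)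
open import Data.Nat using (ℕ; zero; suc; _+_; _*_; _∸_; _%_; _≤_; _<_; z≤n; s≤s; s≤s⁻¹; z<s; NonZero; >-nonZero)
open import Data.Nat.DivMod using (_/_; m≡m%n+[m/n]*n; m%n<n; m/n*n≤m; m≥n⇒m/n>0)
open import Data.Nat.Properties
open import Data.Nat.Tactic.RingSolver using (solve)
open import Data.List using (_∷_; [])
open import Data.Product using (_×_; _,_; proj₁; proj₂)
open import Data.Sum using (_⊎_; inj₁; inj₂; swap)
open import Function using (_∘_)
open import Relation.Nullary using (does; yes; no; contradiction)
open import Relation.Binary.Definitions using (DecidableEquality)
open import Relation.Binary.PropositionalEquality using (_≡_; _≢_; refl; sym; trans; cong; subst)
import Data.Fin as F

private
  variable
    k n L Lp m m′ : ℕ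
    x y w : Vtx k n L Lp

Near : ℕ → ℕ → Set
Near a c = a ≤ suc c × c ≤ suc a

Near-refl : ∀ a → Near a a
Near-refl a = n≤1+n a , n≤1+n a

Near-suc : ∀ a → Near a (suc a)
Near-suc a = m≤n⇒m≤1+n (n≤1+n a) , ≤-refl

Near-0 : ∀ {a} → a ≤ 1 → Near a 0
Near-0 a≤1 = a≤1 , z≤n

Near-+ʳ : ∀ m {a c} → Near a c → Near (a + m) (c + m)
Near-+ʳ m (a≤1+c , c≤1+a) = +-monoˡ-≤ m a≤1+c , +-monoˡ-≤ m c≤1+a

∸-near : ∀ m {a c} → c ≤ suc a → m ∸ a ≤ suc (m ∸ c)
∸-near m {a} {c} c≤1+a = m≤n+o⇒m∸n≤o m a (begin
  m                ≤⟨ m≤n+m∸n m c ⟩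
  c + (m ∸ c)      ≤⟨ +-monoˡ-≤ (m ∸ c) c≤1+a ⟩
  suc a + (m ∸ c)  ≡⟨ sym (+-suc a (m ∸ c)) ⟩
  a + suc (m ∸ c)  ∎)
  where open ≤-Reasoning

Near-∸ˡ : ∀ m {a c} → Near a c → Near (m ∸ a) (m ∸ c)
Near-∸ˡ m (a≤1+c , c≤1+a) = ∸-near m c≤1+a , ∸-near m a≤1+c

m≤1+n⇒m∸n≤1 : ∀ {m n} → m ≤ suc n → m ∸ n ≤ 1
m≤1+n⇒m∸n≤1 {m} {n} m≤1+n = m≤n+o⇒m∸n≤o m n (≤-trans m≤1+n (≤-reflexive (+-comm 1 n)))

_++ʷ_ : Walk x y m → Walk y w m′ → Walk x w (m + m′)
here        ++ʷ v = v
step e rest ++ʷ v = step e (rest ++ʷ v)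

reverse : Walk x y m → Walk y x m
reverse here = here
reverse (step {m = m} e rest) = subst (Walk _ _) (+-comm m 1) (reverse rest ++ʷ step (swap e) here)

walk-lipschitz : (f : Vtx k n L Lp → ℕ) → (∀ {x y} → Edge x y → f y ≤ suc (f x)) →
                 Walk x y m → f y ≤ f x + m
walk-lipschitz f f-edge (here {x}) = m≤m+n (f x) 0
walk-lipschitz f f-edge (step {x} {y′} {m = m} e rest) = begin
  _              ≤⟨ walk-lipschitz f f-edge rest ⟩
  f y′ + m       ≤⟨ +-monoˡ-≤ m (f-edge e) ⟩
  suc (f x) + m  ≡⟨ sym (+-suc (f x) m) ⟩
  f x + suc m    ∎
  where open ≤-Reasoning

depth : ∀ {k n L Lp} → Vtx k n L Lp → ℕ
depth b = 0
depth {L = L} (u' _ _) = L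
depth {L = L} (u _ _) = L
depth {L = L} (z _) = L
depth {L = L} (z' _) = L
depth {L = L} {Lp = Lp} (pv _ t) = (Lp ∸ toℕ t) + L
depth {L = L} (bu _ _ t) = L ∸ suc (toℕ t)
depth {L = L} (bu' _ _ t) = L ∸ suc (toℕ t)

owner : Vtx k n L Lp → Maybe (Fin k)
owner b = nothing
owner (u' i _) = just i
owner (u i _) = just i
owner (z i) = just i
owner (z' i) = just i
owner (pv i _) = just i
owner (bu i _ _) = just i
owner (bu' i _ _) = just i

depth-near : ∀ {k n L Lp} {x y : Vtx k n L Lp} → Arc x y → Near (depth x) (depth y)
depth-near (u'-path _ _ _ _) = Near-refl _
depth-near (u-path _ _ _ _) = Near-refl _
depth-near (z-u' _ _ _) = Near-refl _
depth-near (z-u _ _ _) = Near-refl _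
depth-near (z'-u' _ _ _) = Near-refl _
depth-near (z'-u _ _ _) = Near-refl _
depth-near {L = L} {Lp = Lp} (p-path _ t _ t′≡1+t) rewrite t′≡1+t =
  Near-+ʳ L (Near-∸ˡ Lp (Near-suc (toℕ t)))
depth-near {L = L} (p-end _ _ _ 1+t≡Lp _) =
  Near-+ʳ L (Near-0 (m≤1+n⇒m∸n≤1 (≤-reflexive (sym 1+t≡Lp))))
depth-near {L = L} (bu-start _ _ _ t≡0) rewrite t≡0 = Near-∸ˡ L (Near-suc 0)
depth-near {L = L} (bu-path _ _ t _ t′≡1+t) rewrite t′≡1+t = Near-∸ˡ L (Near-suc (suc (toℕ t)))
depth-near {L = L} (bu-end _ _ _ 1+t≡L∸1) =
  Near-0 (m≤1+n⇒m∸n≤1 (≤-trans (m≤n+m∸n L 1) (≤-reflexive (cong suc (sym 1+t≡L∸1)))))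
depth-near (bu-direct _ _ L≡1) = Near-0 (≤-reflexive L≡1)
depth-near {L = L} (bu'-start _ _ _ t≡0) rewrite t≡0 = Near-∸ˡ L (Near-suc 0)
depth-near {L = L} (bu'-path _ _ t _ t′≡1+t) rewrite t′≡1+t = Near-∸ˡ L (Near-suc (suc (toℕ t)))
depth-near {L = L} (bu'-end _ _ _ 1+t≡L∸1) =
  Near-0 (m≤1+n⇒m∸n≤1 (≤-trans (m≤n+m∸n L 1) (≤-reflexive (cong suc (sym 1+t≡L∸1)))))
depth-near (bu'-direct _ _ L≡1) = Near-0 (≤-reflexive L≡1)

arc-owner : Arc x y → owner x ≡ owner y ⊎ y ≡ b
arc-owner (u'-path _ _ _ _) = inj₁ refl
arc-owner (u-path _ _ _ _) = inj₁ refl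
arc-owner (z-u' _ _ _) = inj₁ refl
arc-owner (z-u _ _ _) = inj₁ refl
arc-owner (z'-u' _ _ _) = inj₁ refl
arc-owner (z'-u _ _ _) = inj₁ refl
arc-owner (p-path _ _ _ _) = inj₁ refl
arc-owner (p-end _ _ _ _ _) = inj₁ refl
arc-owner (bu-start _ _ _ _) = inj₁ refl
arc-owner (bu-path _ _ _ _ _) = inj₁ refl
arc-owner (bu-end _ _ _ _) = inj₂ refl
arc-owner (bu-direct _ _ _) = inj₂ refl
arc-owner (bu'-start _ _ _ _) = inj₁ refl
arc-owner (bu'-path _ _ _ _ _) = inj₁ refl
arc-owner (bu'-end _ _ _ _) = inj₂ refl
arc-owner (bu'-direct _ _ _) = inj₂ refl

toward : Bool → ℕ → ℕ → ℕ
toward true L h = L ∸ h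
toward false L h = h + L

Near-toward : ∀ β L {a c} → Near a c → Near (toward β L a) (toward β L c)
Near-toward true L = Near-∸ˡ L
Near-toward false L = Near-+ʳ L

toward-0 : ∀ β L → toward β L 0 ≡ L
toward-0 true L = refl
toward-0 false L = refl

_≟ₒ_ : ∀ {k} → DecidableEquality (Maybe (Fin k))
_≟ₒ_ = ≡-dec F._≟_

potential : ∀ {k n L Lp} → Fin k → Vtx k n L Lp → ℕ
potential {L = L} j x = toward (does (owner x ≟ₒ just j)) L (depth x)

potential-inside : ∀ (j : Fin k) (x : Vtx k n L Lp) → owner x ≡ just j → potential j x ≡ L ∸ depth x
potential-inside j x owned with owner x ≟ₒ just j
... | yes _ = refl
... | no not-owned = contradiction owned not-owned

potential-outside : ∀ (j : Fin k) (x : Vtx k n L Lp) → owner x ≢ just j → potential j x ≡ depth x + L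
potential-outside j x not-owned with owner x ≟ₒ just j
... | yes owned = contradiction owned not-owned
... | no _ = refl

potential-near : ∀ {k n L Lp} {x y : Vtx k n L Lp} (j : Fin k) → Arc x y → Near (potential j x) (potential j y)
potential-near {L = L} {x = x} {y = y} j a with arc-owner a
... | inj₁ same-owner =
  subst (λ o → Near (potential j x) (toward (does (o ≟ₒ just j)) L (depth y))) same-owner
        (Near-toward (does (owner x ≟ₒ just j)) L (depth-near a))
... | inj₂ refl =
  subst (Near (potential j x)) (toward-0 (does (owner x ≟ₒ just j)) L)
        (Near-toward (does (owner x ≟ₒ just j)) L (depth-near a))

potential-walk : ∀ (j : Fin k) → Walk x y m → potential j y ≤ potential j x + m
potential-walk j = walk-lipschitz (potential j) edge-bound
  where
  edge-bound : Edge x y → potential j y ≤ suc (potential j x)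
  edge-bound (inj₁ a) = proj₂ (potential-near j a)
  edge-bound (inj₂ a) = proj₁ (potential-near j a)

potential-rep : ∀ {k n L Lp} {i j : Fin k} → i ≢ j → (w : Vtx k n L Lp) → HRep i w →
                L + L ≤ potential j w + (n ∸ 1) / 2
potential-rep {n = n} {L} {Lp} {i} {j} i≢j .(pv i t) (inj₁ (t , refl))
  rewrite potential-outside j (pv {n = n} {L} {Lp} i t) (i≢j ∘ just-injective) =
  ≤-trans (+-monoˡ-≤ L (m≤n+m L (Lp ∸ toℕ t))) (m≤m+n _ _)
potential-rep {L = L} {Lp} {i} {j} i≢j .(u i c) (inj₂ (inj₁ (c , _ , refl)))
  rewrite potential-outside j (u {L = L} {Lp} i c) (i≢j ∘ just-injective) = m≤m+n _ _
potential-rep {k} {n} {L} {Lp} {i} {j} i≢j w (inj₂ (inj₂ (c , m , _ , (u⇝w , _) , m≤e))) = begin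
  L + L                              ≡⟨ sym (potential-outside j u-ic (i≢j ∘ just-injective)) ⟩
  potential j u-ic                   ≤⟨ potential-walk j (reverse u⇝w) ⟩
  potential j w + m                  ≤⟨ +-monoʳ-≤ (potential j w) m≤e ⟩
  potential j w + (n ∸ 1) / 2        ∎
  where
  open ≤-Reasoning
  u-ic : Vtx k n L Lp
  u-ic = u i c

far-from-rep : ∀ {k n L Lp m} {w : Vtx k n L Lp} {i j : Fin k} {c : Fin n} →
               i ≢ j → HRep i w → Walk (u' j c) w m →
               L + L ≤ m + (n ∸ 1) / 2
far-from-rep {k} {n} {L} {Lp} {m} {w} {j = j} {c} i≢j w-rep u'⇝w = begin
  L + L                           ≤⟨ potential-rep i≢j w w-rep ⟩
  potential j w + (n ∸ 1) / 2     ≤⟨ +-monoˡ-≤ _ (potential-walk j u'⇝w) ⟩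
  potential j u'-jc + m + (n ∸ 1) / 2
    ≡⟨ cong (λ h → h + m + (n ∸ 1) / 2) (trans (potential-inside j u'-jc refl) (n∸n≡0 L)) ⟩
  m + (n ∸ 1) / 2                 ∎
  where
  open ≤-Reasoning
  u'-jc : Vtx k n L Lp
  u'-jc = u' j c

bu'-b-walk : ∀ {L′} (i : Fin k) (c : Fin n) (t : Fin L′) r → suc (toℕ t) + r ≡ L′ →
             Walk {k} {n} {suc L′} {Lp} (bu' i c t) b (suc r)
bu'-b-walk i c t zero t-last = step (inj₁ (bu'-end i c t (trans (sym (+-identityʳ _)) t-last))) here
bu'-b-walk {L′ = L′} i c t (suc r) t+r+1≡L′ =
  step (inj₁ (bu'-path i c t t′ (toℕ-fromℕ< t+1<L′))) (bu'-b-walk i c t′ r t′+r≡L′)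
  where
  t+1+r≡L′ : suc (suc (toℕ t)) + r ≡ L′
  t+1+r≡L′ = trans (sym (+-suc (suc (toℕ t)) r)) t+r+1≡L′
  t+1<L′ : suc (toℕ t) < L′
  t+1<L′ = ≤-trans (m≤m+n _ r) (≤-reflexive t+1+r≡L′)
  t′ : Fin L′
  t′ = fromℕ< t+1<L′
  t′+r≡L′ : suc (toℕ t′) + r ≡ L′
  t′+r≡L′ = trans (cong (λ s → suc s + r) (toℕ-fromℕ< t+1<L′)) t+1+r≡L′

u'-b-walk : ∀ {k n L Lp} → 0 < L → (i : Fin k) (c : Fin n) → Walk {k} {n} {L} {Lp} (u' i c) b L
u'-b-walk {L = 1} _ i c = step (inj₁ (bu'-direct i c refl)) here
u'-b-walk {L = suc (suc L″)} _ i c = step (inj₁ (bu'-start i c F.zero refl)) (bu'-b-walk i c F.zero L″ refl)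

u'-u'-walk : 0 < L → (i i′ : Fin k) (c c′ : Fin n) → Walk {k} {n} {L} {Lp} (u' i c) (u' i′ c′) (L + L)
u'-u'-walk L>0 i i′ c c′ = u'-b-walk L>0 i c ++ʷ reverse (u'-b-walk L>0 i′ c′)

m≤n*⌈m/n⌉ : ∀ m n .{{_ : NonZero n}} → m ≤ n * ⌈ m / n ⌉
m≤n*⌈m/n⌉ m (suc n) = +-cancelʳ-≤ n m (suc n * Q) (begin
  m + n                          ≡⟨ m≡m%n+[m/n]*n (m + n) (suc n) ⟩
  (m + n) % suc n + Q * suc n    ≤⟨ +-monoˡ-≤ (Q * suc n) (s≤s⁻¹ (m%n<n (m + n) (suc n))) ⟩
  n + Q * suc n                  ≡⟨ cong (n +_) (*-comm Q (suc n)) ⟩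
  n + suc n * Q                  ≡⟨ +-comm n (suc n * Q) ⟩
  suc n * Q + n                  ∎)
  where
  open ≤-Reasoning
  Q = (m + n) / suc n

⌈m/n⌉>0 : ∀ {m n} .{{_ : NonZero n}} → 0 < m → 0 < ⌈ m / n ⌉
⌈m/n⌉>0 {m} {suc n} 0<m = m≥n⇒m/n>0 (+-monoˡ-≤ n 0<m)

[n∸1]/2+[n∸1]/2<n : ∀ {n} → 0 < n → (n ∸ 1) / 2 + (n ∸ 1) / 2 < n
[n∸1]/2+[n∸1]/2<n {suc n} _ = s≤s (begin
  n / 2 + n / 2        ≡⟨ cong (n / 2 +_) (sym (+-identityʳ (n / 2))) ⟩
  2 * (n / 2)          ≡⟨ *-comm 2 (n / 2) ⟩
  n / 2 * 2            ≤⟨ m/n*n≤m n 2 ⟩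
  n                    ∎)
  where open ≤-Reasoning

n%2≡1⇒n>0 : ∀ {n} → n % 2 ≡ 1 → 0 < n
n%2≡1⇒n>0 {suc _} _ = z<s

slack<αdetour : ∀ {n p q L e} → 0 < q → e + e < n → n * q ≤ 2 * p * L → q * (e + e) < p * (L + L)
slack<αdetour {n} {p} {q} {L} {e} 0<q e+e<n nq≤2pL = begin-strict
  q * (e + e)   <⟨ *-monoʳ-< q {{>-nonZero 0<q}} e+e<n ⟩
  q * n         ≡⟨ *-comm q n ⟩
  n * q         ≤⟨ nq≤2pL ⟩
  2 * p * L     ≡⟨ solve (p ∷ L ∷ []) ⟩
  p * (L + L)   ∎
  where open ≤-Reasoning

detour-inequality : ∀ {p q e A d d₁ d₂} → 2 * p ≤ q → q * (e + e) < p * A →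
                    A ≤ d₁ + e → A ≤ d₂ + e → d ≤ A → (q + p) * d < q * (d₁ + d₂)
detour-inequality {p} {q} {e} {A} {d} {d₁} {d₂} 2p≤q slack A≤d₁+e A≤d₂+e d≤A =
  +-cancelʳ-< (q * (e + e)) ((q + p) * d) (q * (d₁ + d₂)) (begin-strict
    (q + p) * d + q * (e + e)    ≤⟨ +-monoˡ-≤ (q * (e + e)) (*-monoʳ-≤ (q + p) d≤A) ⟩
    (q + p) * A + q * (e + e)    <⟨ +-monoʳ-< ((q + p) * A) slack ⟩
    (q + p) * A + p * A          ≡⟨ solve (q ∷ p ∷ A ∷ []) ⟩
    q * A + 2 * p * A            ≤⟨ +-monoʳ-≤ (q * A) (*-monoˡ-≤ A 2p≤q) ⟩
    q * A + q * A                ≤⟨ +-mono-≤ (*-monoʳ-≤ q A≤d₁+e) (*-monoʳ-≤ q A≤d₂+e) ⟩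
    q * (d₁ + e) + q * (d₂ + e)  ≡⟨ solve (q ∷ d₁ ∷ d₂ ∷ e ∷ []) ⟩
    q * (d₁ + d₂) + q * (e + e)  ∎)
  where open ≤-Reasoning

lemma6 : (k n p q : ℕ) → n % 2 ≡ 1 → 0 < p → 2 * p ≤ q →
           (EG : Fin k → Fin n → Fin k → Fin n → Set) →
           (i j l : Fin k) → i ≢ j → i ≢ l → j F.< l →
           (w : V' k n p q) → HRep i w →
           (j' l' : Fin n) → EG j j' l l' →
           (d₁ d₂ d : ℕ) →
           Dist k n p q (u' j j') w d₁ → Dist k n p q w (u' l l') d₂ → Dist k n p q (u' j j') (u' l l') d →
           (q + p) * d < q * (d₁ + d₂)
lemma6 k n p q n-odd 0<p 2p≤q _ i j l i≢j i≢l _ w w-rep j' l' _ d₁ d₂ d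
       (x⇝w , _) (w⇝y , _) (_ , d-minimal) =
  detour-inequality {p} {q} {e} 2p≤q
    (slack<αdetour {n} {p} {q} {Lof n p q} {e} 0<q ([n∸1]/2+[n∸1]/2<n 0<n) (m≤n*⌈m/n⌉ (n * q) (2 * p)))
    (far-from-rep i≢j w-rep x⇝w)
    (far-from-rep i≢l w-rep (reverse w⇝y))
    (d-minimal _ (u'-u'-walk (⌈m/n⌉>0 (*-mono-≤ 0<n 0<q)) j l j' l'))
  where
  e : ℕ
  e = (n ∸ 1) / 2
  0<n : 0 < n
  0<n = n%2≡1⇒n>0 n-odd
  0<2p : 0 < 2 * p
  0<2p = ≤-trans 0<p (m≤m+n p _)
  0<q : 0 < q
  0<q = ≤-trans 0<2p 2p≤q
  instance
    2p≢0 : NonZero (2 * p)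
    2p≢0 = >-nonZero 0<2p
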